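{- Let $a,b$ be positive integers and let $1\leq k\leq a+b$. Then $$\psi_k(K_{a,b})=\begin{cases}a+b & \text{if } k=1,\\ \min\{a,b\}-\left\lfloor\frac{k}{2}\right\rfloor+1 & \text{if } 1<k\leq 2\min\{a,b\}+1,\\ 0 & \text{otherwise.}\end{cases}$$
   Context: $K_{a,b}$ is the complete bipartite graph with parts of sizes $a$ and $b$. For a graph $G=(V,E)$ and a positive integer $k$, a $k$-path vertex cover ($k$-PVC) of $G$ is a set $S\subseteq V$ such that every path on $k$ vertices in $G$ contains at least one vertex of $S$. $\psi_k(G)$ denotes the minimum cardinality of a $k$-PVC of $G$. -}

module Defs where

open import Data.Nat using (ℕ; _<_; _≤_; suc)
open import Data.Fin using (Fin; toℕ)
open import Data.Fin.Subset using (Subset; _∈_; ∣_∣)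
open import Data.Product using (Σ; ∃; _×_)
open import Data.Sum using (_⊎_)
open import Function.Definitions using (Injective)
open import Relation.Binary.PropositionalEquality using (_≡_)

Graph : ℕ → Set₁
Graph n = Fin n → Fin n → Set

-- Complete bipartite graph K_{a,b}: vertices Fin (a + b); vertices with
-- index < a form the first part, the remaining b vertices the second part.
K : (a b : ℕ) → Graph (a Data.Nat.+ b)
K a b i j = (toℕ i < a × a ≤ toℕ j) ⊎ (a ≤ toℕ i × toℕ j < a)

IsPath : ∀ {n} → Graph n → (k : ℕ) → (Fin k → Fin n) → Set
IsPath {n} G k p =
  Injective _≡_ _≡_ p ×
  (∀ (i j : Fin k) → toℕ j ≡ suc (toℕ i) → G (p i) (p j))

IsPVC : ∀ {n} → Graph n → ℕ → Subset n → Set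
IsPVC G k S = ∀ p → IsPath G k p → ∃ λ i → p i ∈ S

IsPsi : ∀ {n} → ℕ → Graph n → ℕ → Set
IsPsi {n} k G m =
  (Σ (Subset n) λ S → IsPVC G k S × ∣ S ∣ ≡ m) ×
  (∀ (S : Subset n) → IsPVC G k S → m ≤ ∣ S ∣)

-- Let m = min(a,b) and t = ⌊k/2⌋.  Everything rests on two facts about
-- paths in K_{a,b}, proved in general form before the theorem.
--   * Paths alternate between the two parts, so a path on k vertices has t
--     distinct vertices in each part (sideVertices).  Hence if one part has
--     fewer than t vertices outside S, S meets every k-path (coverCriterion).
--   * Conversely, free vertex sets X, Y in the two parts with k ≤ 2|X| and
--     k ≤ 2|Y| + 1 can be threaded into an alternating k-path
--     (alternatingPath, valid in any graph joining X and Y completely).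
-- The three cases of the theorem then follow:
--   * k = 1: every vertex is a 1-path, so only the whole vertex set covers.
--   * 1 < k ≤ 2m + 1: keeping t - 1 vertices of the smaller part free gives a
--     cover of size m - t + 1 (trimmedPart); a set of size at most m - t
--     leaves at least t free vertices in each part and k free vertices in
--     total, which the second fact turns into an uncovered k-path
--     (avoidingPath).
--   * k > 2m + 1: the smaller part has fewer than t vertices, so ∅ covers.
module Submission where

open import Defs
open import Data.Nat
  using (ℕ; zero; suc; _≤_; _<_; _+_; _*_; _∸_; _⊓_; _/_; _%_; z≤n; s≤s; s≤s⁻¹; _<?_)
open import Data.Nat.Properties
open import Data.Nat.DivMod using (m≡m%n+[m/n]*n; m%n<n)
open import Data.Bool using (Bool; true; false; not)
import Data.Bool as Bool
open import Data.Bool.Properties using (not-involutive; ¬-not)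
open import Data.Fin using (Fin; toℕ; fromℕ<; zero; suc; _↑ˡ_; _↑ʳ_)
open import Data.Fin.Properties
  using (toℕ-injective; toℕ-fromℕ<; toℕ<n; toℕ-↑ˡ; toℕ-↑ʳ; injective⇒≤; fromℕ<-injective; any?)
  renaming (suc-injective to Fin-suc-injective)
open import Data.Vec using ([]; _∷_; _++_; splitAt; here; there)
open import Data.Vec.Properties using (lookup⇒[]=; []=⇒lookup; lookup-++ˡ; lookup-++ʳ)
open import Data.Fin.Subset using (Subset; ∣_∣; inside; outside; _∈_; _∉_; ∁; ⊥; ⊤)
open import Data.Fin.Subset.Properties
  using (∣⊥∣≡0; ∣⊤∣≡n; ∈⊤; _∈?_; p⊆q⇒∣p∣≤∣q∣; ∣∁p∣≡n∸∣p∣; x∈∁p⇒x∉p)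
open import Data.Product using (Σ; ∃; _×_; _,_; proj₁; proj₂)
open import Data.Sum using (_⊎_; inj₁; inj₂)
open import Function using (_∘_)
open import Function.Definitions using (Injective)
open import Relation.Binary.PropositionalEquality
open import Relation.Nullary using (¬_; Dec; yes; no; does; contradiction)
open import Relation.Nullary.Decidable using (dec-true; dec-false)
open import Algebra.Properties.CommutativeSemigroup +-commutativeSemigroup using (interchange)

-- double n = 2n, by recursion so that double (suc n) unfolds to two sucs.
double : ℕ → ℕ
double zero = zero
double (suc n) = suc (suc (double n))

double≡+ : ∀ n → double n ≡ n + n
double≡+ zero = refl
double≡+ (suc n) = cong suc (trans (cong suc (double≡+ n)) (sym (+-suc n n)))

2*≡double : ∀ n → 2 * n ≡ double n
2*≡double n = trans (cong (n +_) (+-identityʳ n)) (sym (double≡+ n))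

double-mono : ∀ {x y} → x ≤ y → double x ≤ double y
double-mono z≤n = z≤n
double-mono (s≤s x≤y) = s≤s (s≤s (double-mono x≤y))

double-injective : ∀ {x y} → double x ≡ double y → x ≡ y
double-injective {zero} {zero} _ = refl
double-injective {suc x} {suc y} eq = cong suc (double-injective (suc-injective (suc-injective eq)))

double-cancel : ∀ x y → double x ≤ suc (double y) → x ≤ y
double-cancel zero y _ = z≤n
double-cancel (suc x) zero (s≤s ())
double-cancel (suc x) (suc y) (s≤s (s≤s le)) = s≤s (double-cancel x y le)

double≢suc-double : ∀ x y → double x ≢ suc (double y)
double≢suc-double (suc x) (suc y) eq = double≢suc-double x y (suc-injective (suc-injective eq))

halfBounds : ∀ k → double (k / 2) ≤ k × k ≤ suc (double (k / 2))
halfBounds k = bounds (k % 2) (m%n<n k 2) (trans (m≡m%n+[m/n]*n k 2) (cong (k % 2 +_) twice))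
  where
  twice : k / 2 * 2 ≡ double (k / 2)
  twice = trans (*-comm (k / 2) 2) (2*≡double (k / 2))
  bounds : ∀ r → r < 2 → k ≡ r + double (k / 2) → double (k / 2) ≤ k × k ≤ suc (double (k / 2))
  bounds zero _ eq = ≤-reflexive (sym eq) , ≤-trans (≤-reflexive eq) (n≤1+n _)
  bounds (suc zero) _ eq = ≤-trans (n≤1+n _) (≤-reflexive (sym eq)) , ≤-reflexive eq
  bounds (suc (suc r)) (s≤s (s≤s ())) _

data Parity : ℕ → Set where
  even : ∀ h → Parity (double h)
  odd  : ∀ h → Parity (suc (double h))

parity : ∀ n → Parity n
parity zero = even 0
parity (suc n) with parity n
... | even h = odd h
... | odd h = even (suc h)

witness : ∀ {P : Set} (d : Dec P) → does d ≡ true → P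
witness (yes p) _ = p

refutation : ∀ {P : Set} (d : Dec P) → does d ≡ false → ¬ P
refutation (no ¬p) _ = ¬p

members : ∀ {n} (p : Subset n) →
          Σ (Fin ∣ p ∣ → Fin n) λ f → Injective _≡_ _≡_ f × (∀ i → f i ∈ p)
members [] = (λ ()) , (λ { {()} }) , (λ ())
members (inside ∷ p) with members p
... | f , f-inj , f∈p = g , g-inj , g∈
  where
  g : Fin (suc ∣ p ∣) → Fin _
  g zero = zero
  g (suc i) = suc (f i)
  g-inj : Injective _≡_ _≡_ g
  g-inj {zero} {zero} _ = refl
  g-inj {suc i} {suc j} eq = cong suc (f-inj (Fin-suc-injective eq))
  g∈ : ∀ i → g i ∈ inside ∷ p
  g∈ zero = here
  g∈ (suc i) = there (f∈p i)
members (outside ∷ p) with members p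
... | f , f-inj , f∈p = suc ∘ f , f-inj ∘ Fin-suc-injective , there ∘ f∈p

∣++∣ : ∀ {m n} (xs : Subset m) (ys : Subset n) → ∣ xs ++ ys ∣ ≡ ∣ xs ∣ + ∣ ys ∣
∣++∣ [] ys = refl
∣++∣ (inside ∷ xs) ys = cong suc (∣++∣ xs ys)
∣++∣ (outside ∷ xs) ys = ∣++∣ xs ys

∈-++⁻ˡ : ∀ {m n} (xs : Subset m) (ys : Subset n) i → i ↑ˡ n ∈ xs ++ ys → i ∈ xs
∈-++⁻ˡ xs ys i i∈ = lookup⇒[]= i xs (trans (sym (lookup-++ˡ xs ys i)) ([]=⇒lookup i∈))

∈-++⁻ʳ : ∀ {m n} (xs : Subset m) (ys : Subset n) j → m ↑ʳ j ∈ xs ++ ys → j ∈ ys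
∈-++⁻ʳ xs ys j j∈ = lookup⇒[]= j ys (trans (sym (lookup-++ʳ xs ys j)) ([]=⇒lookup j∈))

interval : ∀ {n} (lo r : ℕ) → Subset n
interval {zero} lo r = []
interval {suc n} (suc lo) r = outside ∷ interval lo r
interval {suc n} zero zero = outside ∷ interval zero zero
interval {suc n} zero (suc r) = inside ∷ interval zero r

∣interval∣ : ∀ {n} lo r → lo + r ≤ n → ∣ interval {n} lo r ∣ ≡ r
∣interval∣ {zero} zero zero _ = refl
∣interval∣ {suc n} (suc lo) r (s≤s fits) = ∣interval∣ lo r fits
∣interval∣ {suc n} zero zero _ = ∣interval∣ {n} zero zero z≤n
∣interval∣ {suc n} zero (suc r) (s≤s fits) = cong suc (∣interval∣ zero r fits)

∈-interval : ∀ {n} lo r (v : Fin n) → lo ≤ toℕ v → toℕ v < lo + r → v ∈ interval lo r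
∈-interval zero (suc r) zero _ _ = here
∈-interval zero (suc r) (suc v) _ (s≤s lt) = there (∈-interval zero r v z≤n lt)
∈-interval (suc lo) r (suc v) (s≤s le) (s≤s lt) = there (∈-interval lo r v le lt)

windowPigeonhole : ∀ {t n} lo r (q : Fin t → Fin n) → Injective _≡_ _≡_ q →
                   (∀ i → lo ≤ toℕ (q i) × toℕ (q i) < lo + r) → t ≤ r
windowPigeonhole {t} lo r q q-inj window = injective⇒≤ {f = offset} offset-inj
  where
  base : ∀ i → lo + (toℕ (q i) ∸ lo) ≡ toℕ (q i)
  base i = m+[n∸m]≡n (proj₁ (window i))
  bound : ∀ i → toℕ (q i) ∸ lo < r
  bound i = +-cancelˡ-< lo _ _ (subst (_< lo + r) (sym (base i)) (proj₂ (window i)))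
  offset : Fin t → Fin r
  offset i = fromℕ< (bound i)
  offset-inj : Injective _≡_ _≡_ offset
  offset-inj {i} {j} eq = q-inj (toℕ-injective (begin
    toℕ (q i)                ≡⟨ sym (base i) ⟩
    lo + (toℕ (q i) ∸ lo)    ≡⟨ cong (lo +_) (fromℕ<-injective _ _ (bound i) (bound j) eq) ⟩
    lo + (toℕ (q j) ∸ lo)    ≡⟨ base j ⟩
    toℕ (q j)                ∎))
    where open ≡-Reasoning

-- In any graph, if X = eX[Fin cX] and Y = eY[Fin cY] are disjoint and every
-- vertex of X is adjacent to every vertex of Y in both directions, the
-- sequence x₀ y₀ x₁ y₁ … is a path on k vertices whenever X supplies the
-- ⌈k/2⌉ even positions and Y the ⌊k/2⌋ odd ones.  It lies inside X ∪ Y, so it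
-- satisfies every property shared by the vertices of X and Y.
module _ {n : ℕ} (G : Graph n) {cX cY : ℕ}
  (eX : Fin cX → Fin n) (eY : Fin cY → Fin n)
  (eX-inj : Injective _≡_ _≡_ eX) (eY-inj : Injective _≡_ _≡_ eY)
  (disjoint : ∀ x y → eX x ≢ eY y)
  (XY : ∀ x y → G (eX x) (eY y)) (YX : ∀ x y → G (eY y) (eX x)) where

  alternatingPath : ∀ k → k ≤ double cX → k ≤ suc (double cY) →
    (P : Fin n → Set) → (∀ x → P (eX x)) → (∀ y → P (eY y)) →
    Σ (Fin k → Fin n) λ p → IsPath G k p × (∀ i → P (p i))
  alternatingPath k kX kY P PX PY = path , (path-inj , path-adj) , path-P
    where
    place : ∀ {j} → Parity j → j < k → Fin n
    place (even h) lt = eX (fromℕ< (double-cancel (suc h) cX (s≤s (≤-trans lt kX))))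
    place (odd h) lt = eY (fromℕ< (double-cancel (suc h) cY (≤-trans lt kY)))

    path : Fin k → Fin n
    path i = place (parity (toℕ i)) (toℕ<n i)

    place-inj : ∀ {j j'} (π : Parity j) (π' : Parity j') lt lt' → place π lt ≡ place π' lt' → j ≡ j'
    place-inj (even h) (even h') _ _ eq = cong double (fromℕ<-injective _ _ _ _ (eX-inj eq))
    place-inj (even h) (odd h') _ _ eq = contradiction eq (disjoint _ _)
    place-inj (odd h) (even h') _ _ eq = contradiction (sym eq) (disjoint _ _)
    place-inj (odd h) (odd h') _ _ eq = cong (suc ∘ double) (fromℕ<-injective _ _ _ _ (eY-inj eq))

    place-adj : ∀ {j j'} (π : Parity j) (π' : Parity j') lt lt' → j' ≡ suc j → G (place π lt) (place π' lt')
    place-adj (even h) (odd h') _ _ _ = XY _ _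
    place-adj (odd h) (even h') _ _ _ = YX _ _
    place-adj (even h) (even h') _ _ eq = contradiction eq (double≢suc-double h' h)
    place-adj (odd h) (odd h') _ _ eq = contradiction (suc-injective eq) (double≢suc-double h' h)

    place-P : ∀ {j} (π : Parity j) lt → P (place π lt)
    place-P (even h) _ = PX _
    place-P (odd h) _ = PY _

    path-inj : Injective _≡_ _≡_ path
    path-inj {i} {j} eq = toℕ-injective (place-inj (parity (toℕ i)) (parity (toℕ j)) _ _ eq)

    path-adj : ∀ i j → toℕ j ≡ suc (toℕ i) → G (path i) (path j)
    path-adj i j = place-adj (parity (toℕ i)) (parity (toℕ j)) _ _

    path-P : ∀ i → P (path i)
    path-P i = place-P (parity (toℕ i)) _

module _ (a b : ℕ) where

  side : Fin (a + b) → Bool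
  side v = does (toℕ v <? a)

  firstPart : ∀ v → side v ≡ true → toℕ v < a
  firstPart v = witness (toℕ v <? a)

  secondPart : ∀ v → side v ≡ false → a ≤ toℕ v
  secondPart v = ≮⇒≥ ∘ refutation (toℕ v <? a)

  adjacent-flips : ∀ v w → K a b v w → side w ≡ not (side v)
  adjacent-flips v w (inj₁ (v<a , a≤w)) =
    trans (dec-false (toℕ w <? a) (≤⇒≯ a≤w)) (cong not (sym (dec-true (toℕ v <? a) v<a)))
  adjacent-flips v w (inj₂ (a≤v , w<a)) =
    trans (dec-true (toℕ w <? a) w<a) (cong not (sym (dec-false (toℕ v <? a) (≤⇒≯ a≤v))))

  module _ {k : ℕ} (p : Fin k → Fin (a + b)) (p-path : IsPath (K a b) k p) where

    at : (j : ℕ) → .(j < k) → Fin (a + b)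
    at j lt = p (fromℕ< lt)

    side-step : ∀ j (lt : suc j < k) → side (at (suc j) lt) ≡ not (side (at j (<-trans (n<1+n j) lt)))
    side-step j lt = adjacent-flips _ _ (proj₂ p-path _ _
      (trans (toℕ-fromℕ< lt) (cong suc (sym (toℕ-fromℕ< (<-trans (n<1+n j) lt))))))

    side-period : ∀ s h (lt : double h + s < k) →
      side (at (double h + s) lt) ≡ side (at s (≤-<-trans (m≤n+m s (double h)) lt))
    side-period s zero lt = refl
    side-period s (suc h) lt = begin
      side (at (suc (suc (double h + s))) lt)        ≡⟨ side-step _ lt ⟩
      not (side (at (suc (double h + s)) lt₁))       ≡⟨ cong not (side-step _ lt₁) ⟩
      not (not (side (at (double h + s) lt₂)))       ≡⟨ not-involutive _ ⟩
      side (at (double h + s) lt₂)                   ≡⟨ side-period s h lt₂ ⟩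
      side (at s (≤-<-trans (m≤n+m s (double (suc h))) lt)) ∎
      where
      open ≡-Reasoning
      lt₁ : suc (double h + s) < k
      lt₁ = <-trans (n<1+n _) lt
      lt₂ : double h + s < k
      lt₂ = <-trans (n<1+n _) lt₁

    everyOther : ∀ t s β → s ≤ 1 → double (suc t) ≤ k → (s<k : s < k) → side (at s s<k) ≡ β →
      Σ (Fin (suc t) → Fin k) λ g → Injective _≡_ _≡_ g × (∀ i → side (p (g i)) ≡ β)
    everyOther t s β s≤1 2t≤k _ onβ = g , g-inj , λ i → trans (side-period s (toℕ i) (bound i)) onβ
      where
      bound : (i : Fin (suc t)) → double (toℕ i) + s < k
      bound i = <-≤-trans (s≤s (subst (double (toℕ i) + s ≤_) (+-comm (double t) 1)
                  (+-mono-≤ (double-mono (s≤s⁻¹ (toℕ<n i))) s≤1))) 2t≤k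
      g : Fin (suc t) → Fin k
      g i = fromℕ< (bound i)
      g-inj : Injective _≡_ _≡_ g
      g-inj {i} {j} eq = toℕ-injective (double-injective (+-cancelʳ-≡ s _ _
        (fromℕ<-injective _ _ (bound i) (bound j) eq)))

    -- A path on at least 2t vertices has t distinct vertices in each part:
    -- one of its first two vertices lies in the given part.
    sideVertices : ∀ t → double t ≤ k → ∀ β →
      Σ (Fin t → Fin k) λ g → Injective _≡_ _≡_ g × (∀ i → side (p (g i)) ≡ β)
    sideVertices zero _ β = (λ ()) , (λ { {()} }) , (λ ())
    sideVertices (suc t) 2t≤k β with side (at 0 (≤-trans (s≤s z≤n) 2t≤k)) Bool.≟ β
    ... | yes onβ = everyOther t 0 β z≤n 2t≤k (≤-trans (s≤s z≤n) 2t≤k) onβ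
    ... | no offβ = everyOther t 1 β ≤-refl 2t≤k 1<k
                      (trans (side-step 0 1<k) (sym (¬-not (offβ ∘ sym))))
      where
      1<k : 1 < k
      1<k = ≤-trans (s≤s (s≤s z≤n)) 2t≤k

  -- If all vertices of part β outside S lie in a window narrower than t,
  -- S meets every path on k ≥ 2t vertices: such a path would need t
  -- distinct free vertices of part β.
  coverCriterion : ∀ k t (S : Subset (a + b)) β lo r → double t ≤ k → r < t →
    (∀ v → side v ≡ β → v ∉ S → lo ≤ toℕ v × toℕ v < lo + r) → IsPVC (K a b) k S
  coverCriterion k t S β lo r 2t≤k r<t window p p-path with any? (λ i → p i ∈? S)
  ... | yes hit = hit
  ... | no miss = contradiction (t≤r (sideVertices p p-path t 2t≤k β)) (<⇒≱ r<t)
    where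
    t≤r : (Σ (Fin t → Fin k) λ g → Injective _≡_ _≡_ g × (∀ i → side (p (g i)) ≡ β)) → t ≤ r
    t≤r (g , g-inj , onβ) = windowPigeonhole lo r (p ∘ g) (g-inj ∘ proj₁ p-path)
      (λ i → window _ (onβ i) (λ p∈S → miss (g i , p∈S)))

  record Part (m : ℕ) : Set where
    field
      β : Bool
      lo : ℕ
      fits : lo + m ≤ a + b
      located : ∀ v → side v ≡ β → lo ≤ toℕ v × toℕ v < lo + m

  smallerPart : ∀ m → m ≡ a ⊎ m ≡ b → Part m
  smallerPart .a (inj₁ refl) = record
    { β = true ; lo = 0 ; fits = m≤m+n a b ; located = λ v eq → z≤n , firstPart v eq }
  smallerPart .b (inj₂ refl) = record
    { β = false ; lo = a ; fits = ≤-refl ; located = λ v eq → secondPart v eq , toℕ<n v }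

  -- Covering all but t - 1 vertices of a part of size m gives a k-PVC of
  -- size m - t + 1.
  trimmedPart : ∀ k t m → Part m → double t ≤ k → 1 ≤ t → t ≤ m →
    Σ (Subset (a + b)) λ S → IsPVC (K a b) k S × ∣ S ∣ ≡ m ∸ t + 1
  trimmedPart k zero m part _ () _
  trimmedPart k (suc s) m part 2t≤k _ t≤m =
    S , coverCriterion k (suc s) S β lo s 2t≤k ≤-refl free , ∣interval∣ (lo + s) (m ∸ suc s + 1) S-fits
    where
    open Part part
    split : s + (m ∸ suc s + 1) ≡ m
    split = begin
      s + (m ∸ suc s + 1)   ≡⟨ cong (s +_) (+-comm (m ∸ suc s) 1) ⟩
      s + suc (m ∸ suc s)   ≡⟨ +-suc s (m ∸ suc s) ⟩
      suc s + (m ∸ suc s)   ≡⟨ m+[n∸m]≡n t≤m ⟩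
      m                     ∎
      where open ≡-Reasoning
    end : lo + s + (m ∸ suc s + 1) ≡ lo + m
    end = trans (+-assoc lo s _) (cong (lo +_) split)
    S : Subset (a + b)
    S = interval (lo + s) (m ∸ suc s + 1)
    S-fits : lo + s + (m ∸ suc s + 1) ≤ a + b
    S-fits = subst (_≤ a + b) (sym end) fits
    free : ∀ v → side v ≡ β → v ∉ S → lo ≤ toℕ v × toℕ v < lo + s
    free v onβ v∉S with located v onβ | toℕ v <? lo + s
    ... | lo≤v , _ | yes v<lo+s = lo≤v , v<lo+s
    ... | _ , v<end | no ¬v<lo+s =
      contradiction (∈-interval (lo + s) _ v (≮⇒≥ ¬v<lo+s) (subst (toℕ v <_) (sym end) v<end)) v∉S

Balanced : ℕ → ℕ → ℕ → Set
Balanced k cX cY = k ≤ double cX × k ≤ suc (double cY)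

orient : ∀ {k t cA cB} → t ≤ cA → t ≤ cB → k ≤ cA + cB → k ≤ suc (double t) →
         Balanced k cA cB ⊎ Balanced k cB cA
orient {k} {t} {cA} {cB} tA tB kAB kt with ≤-total cB cA
... | inj₁ B≤A = inj₁ (≤-trans kAB (subst (cA + cB ≤_) (sym (double≡+ cA)) (+-monoʳ-≤ cA B≤A))
                     , ≤-trans kt (s≤s (double-mono tB)))
... | inj₂ A≤B = inj₂ (≤-trans kAB (subst (cA + cB ≤_) (sym (double≡+ cB)) (+-monoˡ-≤ cB A≤B))
                     , ≤-trans kt (s≤s (double-mono tA)))

freeInPart : ∀ {t m a s} → t ≤ m → m ≤ a → s ≤ m ∸ t → t ≤ a ∸ s
freeInPart {t} {m} {a} {s} t≤m m≤a s≤ =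
  m+n≤o⇒m≤o∸n t (≤-trans (+-monoʳ-≤ t s≤) (subst (_≤ a) (sym (m+[n∸m]≡n t≤m)) m≤a))

budget : ∀ {k t m a b} → k ≤ suc (double t) → k ≤ a + b → t ≤ m → m ≤ a → m ≤ b →
         k + (m ∸ t) ≤ a + b
budget {k} {t} {m} {a} {b} kt kab t≤m m≤a m≤b with m≤n⇒m<n∨m≡n t≤m
... | inj₂ refl = subst (_≤ a + b) (sym (trans (cong (k +_) (n∸n≡0 t)) (+-identityʳ k))) kab
... | inj₁ t<m = begin
  k + (m ∸ t)               ≤⟨ +-monoˡ-≤ (m ∸ t) kt ⟩
  suc (double t) + (m ∸ t)  ≡⟨ cong (λ x → suc x + (m ∸ t)) (double≡+ t) ⟩
  suc (t + t + (m ∸ t))     ≡⟨ cong suc (+-assoc t t (m ∸ t)) ⟩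
  suc (t + (t + (m ∸ t)))   ≡⟨ cong (λ x → suc (t + x)) (m+[n∸m]≡n t≤m) ⟩
  suc t + m                 ≤⟨ +-monoˡ-≤ m t<m ⟩
  m + m                     ≤⟨ +-mono-≤ m≤a m≤b ⟩
  a + b                     ∎
  where open ≤-Reasoning

freeInTotal : ∀ {k t m a b sA sB} → k + (m ∸ t) ≤ a + b → sA ≤ a → sB ≤ b → sA + sB ≤ m ∸ t →
              k ≤ (a ∸ sA) + (b ∸ sB)
freeInTotal {k} {t} {m} {a} {b} {sA} {sB} room sA≤a sB≤b s≤ =
  +-cancelʳ-≤ (sA + sB) k _ (≤-trans (+-monoʳ-≤ k s≤) (subst (k + (m ∸ t) ≤_) (sym total) room))
  where
  total : (a ∸ sA) + (b ∸ sB) + (sA + sB) ≡ a + b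
  total = trans (interchange (a ∸ sA) (b ∸ sB) sA sB) (cong₂ _+_ (m∸n+n≡m sA≤a) (m∸n+n≡m sB≤b))

module FreeVertices (a b : ℕ) (xs : Subset a) (ys : Subset b) where

  cA cB : ℕ
  cA = ∣ ∁ xs ∣
  cB = ∣ ∁ ys ∣

  eA : Fin cA → Fin (a + b)
  eA x = proj₁ (members (∁ xs)) x ↑ˡ b

  eB : Fin cB → Fin (a + b)
  eB y = a ↑ʳ proj₁ (members (∁ ys)) y

  eA-inj : Injective _≡_ _≡_ eA
  eA-inj {x} {x'} eq = proj₁ (proj₂ (members (∁ xs))) (toℕ-injective
    (trans (sym (toℕ-↑ˡ _ b)) (trans (cong toℕ eq) (toℕ-↑ˡ _ b))))

  eB-inj : Injective _≡_ _≡_ eB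
  eB-inj {y} {y'} eq = proj₁ (proj₂ (members (∁ ys))) (toℕ-injective (+-cancelˡ-≡ a _ _
    (trans (sym (toℕ-↑ʳ a _)) (trans (cong toℕ eq) (toℕ-↑ʳ a _)))))

  eA<a : ∀ x → toℕ (eA x) < a
  eA<a x = subst (_< a) (sym (toℕ-↑ˡ _ b)) (toℕ<n _)

  a≤eB : ∀ y → a ≤ toℕ (eB y)
  a≤eB y = subst (a ≤_) (sym (toℕ-↑ʳ a _)) (m≤m+n a _)

  disjoint : ∀ x y → eA x ≢ eB y
  disjoint x y eq = <⇒≱ (eA<a x) (subst (λ v → a ≤ toℕ v) (sym eq) (a≤eB y))

  AB : ∀ x y → K a b (eA x) (eB y)
  AB x y = inj₁ (eA<a x , a≤eB y)

  BA : ∀ x y → K a b (eB y) (eA x)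
  BA x y = inj₂ (a≤eB y , eA<a x)

  freeA : ∀ x → eA x ∉ xs ++ ys
  freeA x = x∈∁p⇒x∉p (proj₂ (proj₂ (members (∁ xs))) x) ∘ ∈-++⁻ˡ xs ys _

  freeB : ∀ y → eB y ∉ xs ++ ys
  freeB y = x∈∁p⇒x∉p (proj₂ (proj₂ (members (∁ ys))) y) ∘ ∈-++⁻ʳ xs ys _

-- A set S = xs ++ ys of at most m - t vertices misses some path on k vertices:
-- each part keeps at least t free vertices, k in total, enough to alternate.
avoidingPath : ∀ a b k m t → m ≤ a → m ≤ b → t ≤ m → k ≤ suc (double t) → k ≤ a + b →
  (xs : Subset a) (ys : Subset b) → ∣ xs ∣ + ∣ ys ∣ ≤ m ∸ t →
  Σ (Fin k → Fin (a + b)) λ p → IsPath (K a b) k p × (∀ i → p i ∉ xs ++ ys)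
avoidingPath a b k m t m≤a m≤b t≤m kt kab xs ys small = thread counts
  where
  open FreeVertices a b xs ys
  sA≤ : ∣ xs ∣ ≤ m ∸ t
  sA≤ = ≤-trans (m≤m+n _ _) small
  sB≤ : ∣ ys ∣ ≤ m ∸ t
  sB≤ = ≤-trans (m≤n+m _ _) small
  within : ∀ {s c} → s ≤ m ∸ t → m ≤ c → s ≤ c
  within s≤ m≤c = ≤-trans s≤ (≤-trans (m∸n≤m m t) m≤c)
  counts : Balanced k cA cB ⊎ Balanced k cB cA
  counts = subst₂ (λ x y → Balanced k x y ⊎ Balanced k y x)
    (sym (∣∁p∣≡n∸∣p∣ xs)) (sym (∣∁p∣≡n∸∣p∣ ys))
    (orient (freeInPart t≤m m≤a sA≤) (freeInPart t≤m m≤b sB≤) enoughInTotal kt)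
    where
    enoughInTotal : k ≤ (a ∸ ∣ xs ∣) + (b ∸ ∣ ys ∣)
    enoughInTotal = freeInTotal {t = t} {m = m} (budget kt kab t≤m m≤a m≤b)
      (within sA≤ m≤a) (within sB≤ m≤b) small
  thread : Balanced k cA cB ⊎ Balanced k cB cA →
    Σ (Fin k → Fin (a + b)) λ p → IsPath (K a b) k p × (∀ i → p i ∉ xs ++ ys)
  thread (inj₁ (kA , kB)) =
    alternatingPath (K a b) eA eB eA-inj eB-inj disjoint AB BA k kA kB (_∉ xs ++ ys) freeA freeB
  thread (inj₂ (kB , kA)) =
    alternatingPath (K a b) eB eA eB-inj eA-inj (λ y x → disjoint x y ∘ sym)
      (λ y x → BA x y) (λ y x → AB x y) k kB kA (_∉ xs ++ ys) freeB freeA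

lowerBound : ∀ a b k m t → m ≤ a → m ≤ b → t ≤ m → k ≤ suc (double t) → k ≤ a + b →
  ∀ S → IsPVC (K a b) k S → m ∸ t + 1 ≤ ∣ S ∣
lowerBound a b k m t m≤a m≤b t≤m kt kab S pvc =
  subst (_≤ ∣ S ∣) (+-comm 1 (m ∸ t)) (≰⇒> (uncovered (splitAt a S)))
  where
  uncovered : (∃ λ xs → ∃ λ ys → S ≡ xs ++ ys) → ¬ ∣ S ∣ ≤ m ∸ t
  uncovered (xs , ys , S≡) small
    with avoidingPath a b k m t m≤a m≤b t≤m kt kab xs ys
           (subst (_≤ m ∸ t) (trans (cong ∣_∣ S≡) (∣++∣ xs ys)) small)
  ... | p , p-path , avoids with pvc p p-path
  ... | i , p∈S = avoids i (subst (p i ∈_) S≡ p∈S)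

-- k = 1: each vertex is a path on one vertex, so a 1-PVC is the whole vertex set.
psi-one : ∀ {n} (G : Graph n) → IsPsi 1 G n
psi-one {n} G = (⊤ , (λ p _ → zero , ∈⊤) , ∣⊤∣≡n n) , onlyWhole
  where
  singleton : ∀ v → IsPath G 1 (λ _ → v)
  singleton v = (λ { {zero} {zero} _ → refl }) , λ { zero zero () }
  onlyWhole : ∀ S → IsPVC G 1 S → n ≤ ∣ S ∣
  onlyWhole S pvc = subst (_≤ ∣ S ∣) (∣⊤∣≡n n)
    (p⊆q⇒∣p∣≤∣q∣ {p = ⊤} {q = S} (λ {v} _ → proj₂ (pvc (λ _ → v) (singleton v))))

psi-middle : ∀ a b k m t → m ≡ a ⊎ m ≡ b → m ≤ a → m ≤ b →
  double t ≤ k → k ≤ suc (double t) → 1 ≤ t → t ≤ m → k ≤ a + b → IsPsi k (K a b) (m ∸ t + 1)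
psi-middle a b k m t smaller m≤a m≤b 2t≤k kt 1≤t t≤m kab =
    trimmedPart a b k t m (smallerPart a b m smaller) 2t≤k 1≤t t≤m
  , lowerBound a b k m t m≤a m≤b t≤m kt kab

-- k > 2m + 1: the smaller part has m < t vertices, so ∅ is a k-PVC.
psi-large : ∀ a b k m t → m ≡ a ⊎ m ≡ b → double t ≤ k → m < t → IsPsi k (K a b) 0
psi-large a b k m t smaller 2t≤k m<t =
  (⊥ , coverCriterion a b k t ⊥ β lo m 2t≤k m<t (λ v onβ _ → located v onβ) , ∣⊥∣≡0 (a + b))
  , λ _ _ → z≤n
  where open Part (smallerPart a b m smaller)

mainTheorem3 : (a b k : ℕ) → 1 ≤ a → 1 ≤ b → 1 ≤ k → k ≤ a + b →
    (k ≡ 1 → IsPsi k (K a b) (a + b)) ×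
    (1 < k → k ≤ 2 * (a ⊓ b) + 1 → IsPsi k (K a b) ((a ⊓ b) ∸ (k / 2) + 1)) ×
    (2 * (a ⊓ b) + 1 < k → IsPsi k (K a b) 0)
mainTheorem3 a b k _ _ _ kab =
    (λ { refl → psi-one (K a b) })
  , (λ 1<k k≤2m+1 → let k≤odd = subst (k ≤_) oddBound k≤2m+1 in
       psi-middle a b k m t smaller (m⊓n≤m a b) (m⊓n≤n a b) 2t≤k k≤2t+1
         (double-cancel 1 t (≤-trans 1<k k≤2t+1)) (double-cancel t m (≤-trans 2t≤k k≤odd)) kab)
  , (λ 2m+1<k → psi-large a b k m t smaller 2t≤k
       (double-cancel (suc m) t (≤-trans (subst (_< k) oddBound 2m+1<k) k≤2t+1)))
  where
  m : ℕ
  m = a ⊓ b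
  t : ℕ
  t = k / 2
  smaller : m ≡ a ⊎ m ≡ b
  smaller = ⊓-sel a b
  2t≤k : double t ≤ k
  2t≤k = proj₁ (halfBounds k)
  k≤2t+1 : k ≤ suc (double t)
  k≤2t+1 = proj₂ (halfBounds k)
  oddBound : 2 * m + 1 ≡ suc (double m)
  oddBound = trans (+-comm (2 * m) 1) (cong suc (2*≡double m))
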